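{- Unweighted SSSD enumeration cannot be solved with delay in $o(\Delta)$, even if the graph is connected and has constant average degree. That is, for every algorithm for unweighted SSSD enumeration there are connected input graphs of constant average degree and arbitrarily large maximum degree $\Delta$ on which some delay of the algorithm is $\Omega(\Delta)$.
   Context: Input: an unweighted (directed or undirected) graph $G=(V,E)$ with $V=\{1,\dots,n\}$ and a source $s\in V$, given as read-only adjacency lists; the algorithm may query the degree of any vertex and the next neighbor in any vertex's adjacency list. $\Delta$ denotes the maximum (out-)degree. $d(s,t)$ is the hop distance from $s$ to $t$ ($\infty$ if unreachable, $d(s,s)=0$). SSSD enumeration: output, for each $t\in V$, the pair $(t,d(s,t))$ exactly once. Delay: maximum time until the first output, between consecutive outputs, and from the last output until termination is signalled (no preprocessing beyond this). -}

module Defs where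

open import Data.Nat using (ℕ; zero; suc; _+_; _*_; _⊔_; _≤_; _<_)
open import Data.Fin using (Fin)
open import Data.List using (List; []; _∷_; length; map; foldr; allFin)
open import Data.Nat.ListAction using (sum)
open import Data.List.Membership.Propositional using (_∈_; _∉_)
open import Data.List.Relation.Unary.Unique.Propositional using (Unique)
open import Data.List.Relation.Unary.Any using (Any)
open import Data.List.Relation.Unary.All using (All)
open import Data.List.Relation.Binary.Permutation.Propositional using (_↭_)
open import Data.Maybe using (Maybe; just; nothing)
open import Data.Product using (_×_; _,_; ∃; proj₁)
open import Relation.Nullary using (¬_)
open import Relation.Binary.PropositionalEquality using (_≡_)

-- Graphs as read-only adjacency lists on the vertex set Fin n
-- (Fin n plays the role of {1,…,n}).

Graph : ℕ → Set
Graph n = Fin n → List (Fin n)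

deg : ∀ {n} → Graph n → Fin n → ℕ
deg G v = length (G v)

maxDeg : ∀ {n} → Graph n → ℕ
maxDeg {n} G = foldr _⊔_ 0 (map (deg G) (allFin n))

-- sum of degrees (average degree = degSum / n)
degSum : ∀ {n} → Graph n → ℕ
degSum {n} G = sum (map (deg G) (allFin n))

SimpleUndirected : ∀ {n} → Graph n → Set
SimpleUndirected {n} G =
  (∀ v → v ∉ G v) × (∀ v → Unique (G v)) × (∀ u v → v ∈ G u → u ∈ G v)

data Walk {n} (G : Graph n) (s : Fin n) : Fin n → ℕ → Set where
  here : Walk G s s 0
  step : ∀ {u v k} → Walk G s u k → v ∈ G u → Walk G s v (suc k)

Connected : ∀ {n} → Graph n → Set
Connected G = ∀ u v → ∃ λ k → Walk G u v k

-- IsDist G s t d : d is the hop distance d(s,t); nothing encodes ∞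
IsDist : ∀ {n} → Graph n → Fin n → Fin n → Maybe ℕ → Set
IsDist G s t (just k) = Walk G s t k × (∀ j → j < k → ¬ Walk G s t j)
IsDist G s t nothing  = ∀ k → ¬ Walk G s t k

-- Each elementary action (degree query, neighbour query, output,
-- termination signal) costs one time unit; internal computation is
-- folded into the (arbitrary) transition function.

data Action (n : ℕ) (S : Set) : Set where
  degQ : Fin n → (ℕ → S) → Action n S
  -- i-th entry (0-based) of v's adjacency list, nothing if i ≥ deg v
  nbrQ : Fin n → ℕ → (Maybe (Fin n) → S) → Action n S
  out  : Fin n → Maybe ℕ → S → Action n S
  halt : Action n S

record Algorithm : Set₁ where
  field
    State : ℕ → Set
    init  : (n : ℕ) → Fin n → State n
    act   : ∀ {n} → State n → Action n (State n)

data Tick (n : ℕ) : Set where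
  silent : Tick n
  emit   : Fin n → Maybe ℕ → Tick n
  stop   : Tick n

nth : ∀ {A : Set} → List A → ℕ → Maybe A
nth []       _       = nothing
nth (x ∷ xs) zero    = just x
nth (x ∷ xs) (suc i) = nth xs i

run : ∀ (A : Algorithm) {n} → Graph n → Algorithm.State A n → ℕ → List (Tick n)
run A G σ zero = []
run A G σ (suc f) with Algorithm.act A σ
... | degQ v k  = silent ∷ run A G (k (deg G v)) f
... | nbrQ v i k = silent ∷ run A G (k (nth (G v) i)) f
... | out t d σ' = emit t d ∷ run A G σ' f
... | halt       = stop ∷ []

trace : (A : Algorithm) → ∀ {n} → Graph n → Fin n → ℕ → List (Tick n)
trace A {n} G s fuel = run A G (Algorithm.init A n s) fuel

IsStop : ∀ {n} → Tick n → Set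
IsStop t = t ≡ stop

Terminated : ∀ {n} → List (Tick n) → Set
Terminated ts = Any IsStop ts

outputs : ∀ {n} → List (Tick n) → List (Fin n × Maybe ℕ)
outputs [] = []
outputs (silent ∷ ts) = outputs ts
outputs (emit t d ∷ ts) = (t , d) ∷ outputs ts
outputs (stop ∷ ts) = outputs ts

-- lengths of the gaps: start → first output, output → output,
-- last output → termination signal.  c = steps since last event.
gapsFrom : ∀ {n} → ℕ → List (Tick n) → List ℕ
gapsFrom c [] = []
gapsFrom c (silent ∷ ts)   = gapsFrom (suc c) ts
gapsFrom c (emit _ _ ∷ ts) = suc c ∷ gapsFrom 0 ts
gapsFrom c (stop ∷ ts)     = suc c ∷ gapsFrom 0 ts

delay : ∀ {n} → List (Tick n) → ℕ
delay ts = foldr _⊔_ 0 (gapsFrom 0 ts)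

CorrectOutput : ∀ {n} → Graph n → Fin n → List (Fin n × Maybe ℕ) → Set
CorrectOutput {n} G s os =
  (map proj₁ os ↭ allFin n) × All (λ p → IsDist G s (proj₁ p) (Data.Product.proj₂ p)) os

SolvesSSSD : Algorithm → Set
SolvesSSSD A = ∀ n (G : Graph n) (s : Fin n) → SimpleUndirected G →
  ∃ λ fuel → Terminated (trace A G s fuel) × CorrectOutput G s (outputs (trace A G s fuel))

-- Adversary argument. Let m = D + 1 and let G₀ consist of a source s adjacent to vertices
-- a i and b j (i , j < m) that form a complete bipartite graph, together with a separate
-- tree: a root r, hubs h k below r and leaves ℓ k l below h k. For a pair p = (i , j) the
-- graph Gₚ replaces the edges a i – b j and h i – ℓ i j by a i – h i and b j – ℓ i j in
-- place, so every adjacency list keeps its length and differs from G₀ in at most one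
-- entry; Gₚ is connected, its degree sum is below 4n and its maximum degree is 2m.
-- In m² − 1 steps an algorithm reads fewer than m² entries, so for some p it cannot tell
-- G₀ from Gₚ. Its outputs so far are then correct for both graphs; a tree vertex is at
-- distance ∞ in G₀ but at finite distance in Gₚ, so only the 2m + 1 vertices near s can
-- have been output and the run on Gₚ has not ended. Hence m² − 1 steps are cut into at
-- most 2m + 2 gaps, and some delay is at least about m / 2.

module Submission where

open import Defs
open import Data.Nat using (ℕ; zero; suc; pred; _+_; _*_; _⊔_; _≤_; _<_; z≤n; s≤s)
open import Data.Nat.Properties
open import Data.Nat.ListAction using (sum)
open import Data.Nat.Solver using (module +-*-Solver)
open import Data.Fin using (Fin; zero; suc; splitAt)
import Data.Fin as Fin
open import Data.Fin.Properties using (+↔⊎; 1↔⊤; *↔×)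
open import Data.List using (List; []; _∷_; _++_; length; map; foldr; tabulate; allFin)
open import Data.List.Properties
  using (length-map; length-++; length-tabulate; map-++; map-tabulate; tabulate-cong)
open import Data.List.Relation.Unary.Any using (here; there)
open import Data.List.Relation.Unary.Any.Properties using (++⁻)
open import Data.List.Relation.Unary.All as All using (All; []; _∷_)
import Data.List.Relation.Unary.All.Properties as Allₚ
open import Data.List.Relation.Unary.All.Properties.Core using (¬All⇒Any¬)
open import Data.List.Relation.Unary.AllPairs using ([]; _∷_)
open import Data.List.Relation.Unary.Unique.Propositional using (Unique)
import Data.List.Relation.Unary.Unique.Propositional.Properties as Unique
open import Data.List.Relation.Binary.Permutation.Propositional using (_↭_; ↭-sym; ↭⇒↭ₛ)
open import Data.List.Relation.Binary.Permutation.Propositional.Properties using (∈-resp-↭)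
open import Data.List.Relation.Binary.Permutation.Setoid.Properties using (Unique-resp-↭)
open import Data.List.Membership.Propositional using (_∈_; _∉_; find)
open import Data.List.Membership.Propositional.Properties
  using (∈-++⁺ˡ; ∈-++⁺ʳ; ∈-++⁻; ∈-map⁺; ∈-map⁻; ∈-allFin; ∈-tabulate⁺; ∈-tabulate⁻)
import Data.List.Membership.DecPropositional as DecMembership
open import Data.Maybe using (Maybe; just; nothing; maybe)
import Data.Maybe.Properties as Maybeₚ
import Data.Product.Properties as Productₚ
open import Data.Product using (Σ; ∃; _×_; _,_; proj₁; proj₂; map₂)
open import Data.Sum using (_⊎_; inj₁; inj₂)
import Data.Sum as Sum
open import Data.Sum.Function.Propositional using (_⊎-↔_)
open import Data.Empty using (⊥; ⊥-elim)
open import Data.Unit using (⊤; tt)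
open import Function using (_∘_; id)
open import Function.Bundles using (_↔_; Inverse; Injection)
open import Function.Properties.Inverse using (↔-refl; ↔-sym; ↔-trans; ↔⇒↣)
open import Relation.Nullary using (¬_; yes; no; contradiction)
open import Relation.Binary.Definitions using (DecidableEquality)
open import Relation.Binary.PropositionalEquality

module _ {X : Set} (_≟_ : DecidableEquality X) where

  private
    remove : X → List X → List X
    remove x [] = []
    remove x (y ∷ ys) with x ≟ y
    ... | yes _ = ys
    ... | no _ = y ∷ remove x ys

    length-remove : ∀ {x ys} → x ∈ ys → suc (length (remove x ys)) ≡ length ys
    length-remove {x} {y ∷ ys} x∈ with x ≟ y
    length-remove {x} {y ∷ ys} x∈          | yes _ = refl
    length-remove {x} {y ∷ ys} (here x≡y)  | no x≢y = contradiction x≡y x≢y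
    length-remove {x} {y ∷ ys} (there x∈)  | no _ = cong suc (length-remove x∈)

    ∈-remove : ∀ {x z ys} → z ∈ ys → z ≢ x → z ∈ remove x ys
    ∈-remove {x} {z} {y ∷ ys} z∈ z≢x with x ≟ y
    ∈-remove (here refl) z≢x | yes refl = contradiction refl z≢x
    ∈-remove (there z∈)  z≢x | yes _ = z∈
    ∈-remove (here z≡y)  z≢x | no _ = here z≡y
    ∈-remove (there z∈)  z≢x | no _ = there (∈-remove z∈ z≢x)

  unique-⊆⇒length≤ : ∀ {xs ys} → Unique xs → (∀ {z} → z ∈ xs → z ∈ ys) → length xs ≤ length ys
  unique-⊆⇒length≤ {[]} _ _ = z≤n
  unique-⊆⇒length≤ {x ∷ xs} {ys} (x∉xs ∷ unique) xs⊆ys = begin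
    suc (length xs)               ≤⟨ s≤s (unique-⊆⇒length≤ unique xs⊆ys-x) ⟩
    suc (length (remove x ys))    ≡⟨ length-remove (xs⊆ys (here refl)) ⟩
    length ys                     ∎
    where
    open ≤-Reasoning
    xs⊆ys-x : ∀ {z} → z ∈ xs → z ∈ remove x ys
    xs⊆ys-x z∈ = ∈-remove (xs⊆ys (there z∈)) λ { refl → All.lookup x∉xs z∈ refl }

  shorter⇒∃∉ : ∀ {xs ys} → Unique xs → length ys < length xs → ∃ λ x → x ∈ xs × x ∉ ys
  shorter⇒∃∉ {xs} {ys} unique ys<xs = find (¬All⇒Any¬ (_∈? ys) xs all∉)
    where
    open DecMembership _≟_ using (_∈?_)
    all∉ : ¬ All (_∈ ys) xs
    all∉ all∈ = <⇒≱ ys<xs (unique-⊆⇒length≤ unique (All.lookup all∈))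

Unique-++⁻ˡ : ∀ {X : Set} (xs : List X) {ys} → Unique (xs ++ ys) → Unique xs
Unique-++⁻ˡ [] _ = []
Unique-++⁻ˡ (x ∷ xs) (x∉ ∷ unique) = Allₚ.++⁻ˡ xs x∉ ∷ Unique-++⁻ˡ xs unique

maximum : List ℕ → ℕ
maximum = foldr _⊔_ 0

≤-maximum : ∀ {x} xs → x ∈ xs → x ≤ maximum xs
≤-maximum (y ∷ xs) (here refl) = m≤m⊔n y (maximum xs)
≤-maximum (y ∷ xs) (there x∈)  = ≤-trans (≤-maximum xs x∈) (m≤n⊔m y (maximum xs))

maximum-≤ : ∀ {b} xs → All (_≤ b) xs → maximum xs ≤ b
maximum-≤ [] [] = z≤n
maximum-≤ (x ∷ xs) (x≤b ∷ xs≤b) = ⊔-lub x≤b (maximum-≤ xs xs≤b)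

nth-map : ∀ {X Y : Set} (f : X → Y) xs i → nth (map f xs) i ≡ Data.Maybe.map f (nth xs i)
nth-map f [] i = refl
nth-map f (x ∷ xs) zero = refl
nth-map f (x ∷ xs) (suc i) = nth-map f xs i

AgreeAt : ∀ {n} → Graph n → Graph n → Fin n × ℕ → Set
AgreeAt G G′ (v , i) = nth (G v) i ≡ nth (G′ v) i

∷-prefix : ∀ {X : Set} (x : X) {xs ys} →
  (∃ λ rest → xs ≡ ys ++ rest) → ∃ λ rest → x ∷ xs ≡ (x ∷ ys) ++ rest
∷-prefix x (rest , eq) = rest , cong (x ∷_) eq

module _ (A : Algorithm) {n : ℕ} where
  open Algorithm A

  neighbourQueries : Graph n → State n → ℕ → List (Fin n × ℕ)
  neighbourQueries G σ zero = []
  neighbourQueries G σ (suc f) with act σ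
  ... | degQ v k   = neighbourQueries G (k (deg G v)) f
  ... | nbrQ v i k = (v , i) ∷ neighbourQueries G (k (nth (G v) i)) f
  ... | out t d σ′ = neighbourQueries G σ′ f
  ... | halt       = []

  length-neighbourQueries : ∀ G σ f → length (neighbourQueries G σ f) ≤ f
  length-neighbourQueries G σ zero = z≤n
  length-neighbourQueries G σ (suc f) with act σ
  ... | degQ v k   = m≤n⇒m≤1+n (length-neighbourQueries G (k (deg G v)) f)
  ... | nbrQ v i k = s≤s (length-neighbourQueries G (k (nth (G v) i)) f)
  ... | out t d σ′ = m≤n⇒m≤1+n (length-neighbourQueries G σ′ f)
  ... | halt       = z≤n

  run-cong : ∀ {G G′} → (∀ v → deg G v ≡ deg G′ v) → ∀ σ f →
    All (AgreeAt G G′) (neighbourQueries G σ f) → run A G σ f ≡ run A G′ σ f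
  run-cong same-deg σ zero _ = refl
  run-cong {G} {G′} same-deg σ (suc f) agree with act σ
  ... | degQ v k rewrite same-deg v = cong (silent ∷_) (run-cong same-deg (k (deg G′ v)) f agree)
  ... | nbrQ v i k with agree
  ...   | same ∷ agree′ rewrite sym same = cong (silent ∷_) (run-cong same-deg (k (nth (G v) i)) f agree′)
  run-cong same-deg σ (suc f) agree | out t d σ′ = cong (emit t d ∷_) (run-cong same-deg σ′ f agree)
  run-cong same-deg σ (suc f) agree | halt = refl

  run-prefix : ∀ (G : Graph n) σ f k → Terminated (run A G σ f) →
    ∃ λ rest → run A G σ f ≡ run A G σ k ++ rest
  run-prefix G σ zero k ()
  run-prefix G σ (suc f) zero _ = _ , refl
  run-prefix G σ (suc f) (suc k) stops with act σ
  ... | degQ v k′ with stops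
  ...   | there stops′ = ∷-prefix silent (run-prefix G (k′ (deg G v)) f k stops′)
  run-prefix G σ (suc f) (suc k) stops | nbrQ v i k′ with stops
  ...   | there stops′ = ∷-prefix silent (run-prefix G (k′ (nth (G v) i)) f k stops′)
  run-prefix G σ (suc f) (suc k) stops | out t d σ′ with stops
  ...   | there stops′ = ∷-prefix (emit t d) (run-prefix G σ′ f k stops′)
  run-prefix G σ (suc f) (suc k) stops | halt = [] , refl

  length-run : ∀ (G : Graph n) σ f → ¬ Terminated (run A G σ f) → length (run A G σ f) ≡ f
  length-run G σ zero _ = refl
  length-run G σ (suc f) running with act σ
  ... | degQ v k   = cong suc (length-run G (k (deg G v)) f (running ∘ there))
  ... | nbrQ v i k = cong suc (length-run G (k (nth (G v) i)) f (running ∘ there))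
  ... | out t d σ′ = cong suc (length-run G σ′ f (running ∘ there))
  ... | halt       = contradiction (here refl) running

outputs-++ : ∀ {n} (xs ys : List (Tick n)) → outputs (xs ++ ys) ≡ outputs xs ++ outputs ys
outputs-++ [] ys = refl
outputs-++ (silent ∷ xs) ys = outputs-++ xs ys
outputs-++ (emit t d ∷ xs) ys = cong ((t , d) ∷_) (outputs-++ xs ys)
outputs-++ (stop ∷ xs) ys = outputs-++ xs ys

∈-outputs-++ˡ : ∀ {n} {o} (xs ys : List (Tick n)) → o ∈ outputs xs → o ∈ outputs (xs ++ ys)
∈-outputs-++ˡ xs ys o∈ = subst (_ ∈_) (sym (outputs-++ xs ys)) (∈-++⁺ˡ o∈)

maxGap : ∀ {n} → ℕ → List (Tick n) → ℕ
maxGap c ts = maximum (gapsFrom c ts)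

gap≤maxGap : ∀ {n} c (ts : List (Tick n)) → Terminated ts → suc c ≤ maxGap c ts
gap≤maxGap c (silent ∷ ts) (there stops) = ≤-trans (n≤1+n (suc c)) (gap≤maxGap (suc c) ts stops)
gap≤maxGap c (emit _ _ ∷ ts) _ = m≤m⊔n (suc c) (maxGap 0 ts)
gap≤maxGap c (stop ∷ ts) _ = m≤m⊔n (suc c) (maxGap 0 ts)

1≤delay : ∀ {n} (ts : List (Tick n)) → Terminated ts → 1 ≤ delay ts
1≤delay = gap≤maxGap 0

-- A halt-free stretch with e outputs lies within e + 1 gaps.
length≤gaps*maxGap : ∀ {n} c (pre rest : List (Tick n)) → ¬ Terminated pre → Terminated rest →
  c + length pre ≤ suc (length (outputs pre)) * maxGap c (pre ++ rest)
length≤gaps*maxGap c [] rest _ stops = begin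
  c + 0              ≡⟨ +-identityʳ c ⟩
  c                  ≤⟨ n≤1+n c ⟩
  suc c              ≤⟨ gap≤maxGap c rest stops ⟩
  maxGap c rest      ≡⟨ sym (+-identityʳ _) ⟩
  1 * maxGap c rest  ∎
  where open ≤-Reasoning
length≤gaps*maxGap c (silent ∷ pre) rest running stops = begin
  c + suc (length pre)  ≡⟨ +-suc c (length pre) ⟩
  suc c + length pre    ≤⟨ length≤gaps*maxGap (suc c) pre rest (running ∘ there) stops ⟩
  _                     ∎
  where open ≤-Reasoning
length≤gaps*maxGap c (emit t d ∷ pre) rest running stops = begin
  c + suc (length pre)        ≡⟨ +-suc c (length pre) ⟩
  suc c + length pre          ≤⟨ +-mono-≤ (m≤m⊔n (suc c) M)
                                          (length≤gaps*maxGap 0 pre rest (running ∘ there) stops) ⟩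
  (suc c ⊔ M) + suc e * M     ≤⟨ +-monoʳ-≤ (suc c ⊔ M) (*-monoʳ-≤ (suc e) (m≤n⊔m (suc c) M)) ⟩
  (suc c ⊔ M) + suc e * (suc c ⊔ M) ∎
  where
  open ≤-Reasoning
  e M : ℕ
  e = length (outputs pre)
  M = maxGap 0 (pre ++ rest)
length≤gaps*maxGap c (stop ∷ pre) rest running stops = contradiction (here refl) running

module _ {n : ℕ} {G : Graph n} where

  Reachable : Fin n → Fin n → Set
  Reachable u v = ∃ λ k → Walk G u v k

  reachable-step : ∀ {u v w} → Reachable u v → w ∈ G v → Reachable u w
  reachable-step (k , walk) w∈ = suc k , step walk w∈

  walk-cons : ∀ {u v t k} → v ∈ G u → Walk G v t k → Walk G u t (suc k)
  walk-cons v∈ here = step here v∈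
  walk-cons v∈ (step walk w∈) = step (walk-cons v∈ walk) w∈

  walk-reverse : (∀ u v → v ∈ G u → u ∈ G v) → ∀ {u v k} → Walk G u v k → Walk G v u k
  walk-reverse symmetric here = here
  walk-reverse symmetric (step walk v∈) = walk-cons (symmetric _ _ v∈) (walk-reverse symmetric walk)

  reachable-trans : ∀ {u v w} → Reachable u v → Reachable v w → Reachable u w
  reachable-trans uv (_ , here) = uv
  reachable-trans uv (_ , step vw w∈) = reachable-step (reachable-trans uv (_ , vw)) w∈

  connected-from-root : (∀ u v → v ∈ G u → u ∈ G v) → ∀ r → (∀ v → Reachable r v) → Connected G
  connected-from-root symmetric r reach u v =
    reachable-trans (map₂ (walk-reverse symmetric) (reach u)) (reach v)

module _ (A : Algorithm) (solves : SolvesSSSD A) {n : ℕ} {G₀ G₁ : Graph n} {s : Fin n}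
  (simple₀ : SimpleUndirected G₀) (simple₁ : SimpleUndirected G₁) (connected₁ : Connected G₁)
  (N : List (Fin n)) (reachable₀⊆N : ∀ {t k} → Walk G₀ s t k → t ∈ N) (far : ∃ λ t → t ∉ N)
  {K : ℕ} (same-prefix : trace A G₀ s K ≡ trace A G₁ s K) where

  private
    σ₀ : Algorithm.State A n
    σ₀ = Algorithm.init A n s

    prefix : List (Tick n)
    prefix = trace A G₁ s K

    prefix-output-correct : ∀ {G} → SimpleUndirected G → ∀ {t d} →
      (t , d) ∈ outputs (trace A G s K) → IsDist G s t d
    prefix-output-correct {G} simple o∈ with solves n G s simple
    ... | fuel , stops , _ , correct with run-prefix A G σ₀ fuel K stops
    ...   | rest , eq =
      All.lookup correct (subst (λ ts → _ ∈ outputs ts) (sym eq) (∈-outputs-++ˡ (trace A G s K) rest o∈))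

    output∈N : ∀ {t d} → (t , d) ∈ outputs prefix → t ∈ N
    output∈N {d = just k} o∈ =
      reachable₀⊆N (proj₁ (prefix-output-correct simple₀ (subst (λ ts → _ ∈ outputs ts) (sym same-prefix) o∈)))
    output∈N {t} {nothing} o∈ = ⊥-elim (prefix-output-correct simple₁ o∈ _ (proj₂ (connected₁ s t)))

    solution₁ : ∃ λ fuel → Terminated (trace A G₁ s fuel) × CorrectOutput G₁ s (outputs (trace A G₁ s fuel))
    solution₁ = solves n G₁ s simple₁

    fuel₁ : ℕ
    fuel₁ = proj₁ solution₁

    outputs-permute : map proj₁ (outputs (trace A G₁ s fuel₁)) ↭ allFin n
    outputs-permute = proj₁ (proj₂ (proj₂ solution₁))

    prefix-running : ¬ Terminated prefix
    prefix-running stops with run-prefix A G₁ σ₀ K fuel₁ stops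
    ... | rest , eq with ∈-map⁻ proj₁ (∈-resp-↭ (↭-sym outputs-permute) (∈-allFin (proj₁ far)))
    ...   | o , o∈ , refl =
      proj₂ far (output∈N (subst (λ ts → o ∈ outputs ts) (sym eq) (∈-outputs-++ˡ (trace A G₁ s fuel₁) rest o∈)))

    prefix-vertices-unique : Unique (map proj₁ (outputs prefix))
    prefix-vertices-unique with run-prefix A G₁ σ₀ fuel₁ K (proj₁ (proj₂ solution₁))
    ... | rest , eq = Unique-++⁻ˡ (map proj₁ (outputs prefix)) (subst Unique vertices-split full-unique)
      where
      full-unique : Unique (map proj₁ (outputs (trace A G₁ s fuel₁)))
      full-unique = Unique-resp-↭ (setoid (Fin n)) (↭⇒↭ₛ (↭-sym outputs-permute)) (Unique.allFin⁺ n)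
      vertices-split : map proj₁ (outputs (trace A G₁ s fuel₁))
                     ≡ map proj₁ (outputs prefix) ++ map proj₁ (outputs rest)
      vertices-split = begin
        map proj₁ (outputs (trace A G₁ s fuel₁))           ≡⟨ cong (map proj₁ ∘ outputs) eq ⟩
        map proj₁ (outputs (prefix ++ rest))               ≡⟨ cong (map proj₁) (outputs-++ prefix rest) ⟩
        map proj₁ (outputs prefix ++ outputs rest)         ≡⟨ map-++ proj₁ (outputs prefix) (outputs rest) ⟩
        map proj₁ (outputs prefix) ++ map proj₁ (outputs rest) ∎
        where open ≡-Reasoning

    few-outputs : length (outputs prefix) ≤ length N
    few-outputs = subst (_≤ length N) (length-map proj₁ (outputs prefix))
      (unique-⊆⇒length≤ Fin._≟_ prefix-vertices-unique vertex∈N)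
      where
      vertex∈N : ∀ {t} → t ∈ map proj₁ (outputs prefix) → t ∈ N
      vertex∈N t∈ with ∈-map⁻ proj₁ t∈
      ... | (t , d) , o∈ , refl = output∈N o∈

  indistinguishable⇒slow : ∀ fuel → Terminated (trace A G₁ s fuel) →
    K ≤ suc (length N) * delay (trace A G₁ s fuel)
  indistinguishable⇒slow fuel stops with run-prefix A G₁ σ₀ fuel K stops
  ... | rest , eq with ++⁻ prefix (subst Terminated eq stops)
  ...   | inj₁ prefix-stops = contradiction prefix-stops prefix-running
  ...   | inj₂ rest-stops = begin
    K                                                 ≡⟨ sym (length-run A G₁ σ₀ K prefix-running) ⟩
    length prefix                                     ≤⟨ length≤gaps*maxGap 0 prefix rest prefix-running rest-stops ⟩
    suc (length (outputs prefix)) * delay (prefix ++ rest) ≤⟨ *-monoˡ-≤ _ (s≤s few-outputs) ⟩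
    suc (length N) * delay (prefix ++ rest)           ≡⟨ cong (λ ts → suc (length N) * delay ts) (sym eq) ⟩
    suc (length N) * delay (trace A G₁ s fuel)        ∎
    where open ≤-Reasoning

+↔⊎-cong : ∀ {x y} {A B : Set} → Fin x ↔ A → Fin y ↔ B → Fin (x + y) ↔ (A ⊎ B)
+↔⊎-cong e₁ e₂ = ↔-trans +↔⊎ (e₁ ⊎-↔ e₂)

∑ : ∀ {k} → (Fin k → ℕ) → ℕ
∑ f = sum (tabulate f)

∑-cong : ∀ {k} {f g : Fin k → ℕ} → (∀ i → f i ≡ g i) → ∑ f ≡ ∑ g
∑-cong f≗g = cong sum (tabulate-cong f≗g)

∑-const : ∀ {k} {f : Fin k → ℕ} {c} → (∀ i → f i ≡ c) → ∑ f ≡ k * c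
∑-const {zero} f≗c = refl
∑-const {suc k} f≗c = cong₂ _+_ (f≗c zero) (∑-const (f≗c ∘ suc))

∑-splitAt : ∀ x {y} (g : Fin x ⊎ Fin y → ℕ) → ∑ (g ∘ splitAt x) ≡ ∑ (g ∘ inj₁) + ∑ (g ∘ inj₂)
∑-splitAt zero g = refl
∑-splitAt (suc x) g = begin
  g (inj₁ zero) + ∑ (g′ ∘ splitAt x)                     ≡⟨ cong (g (inj₁ zero) +_) (∑-splitAt x g′) ⟩
  g (inj₁ zero) + (∑ (g′ ∘ inj₁) + ∑ (g ∘ inj₂))         ≡⟨ sym (+-assoc (g (inj₁ zero)) _ _) ⟩
  g (inj₁ zero) + ∑ (g′ ∘ inj₁) + ∑ (g ∘ inj₂)           ∎
  where
  open ≡-Reasoning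
  g′ : Fin x ⊎ Fin _ → ℕ
  g′ = g ∘ Sum.map suc id

∑-+↔⊎-cong : ∀ {x y} {A B : Set} (e₁ : Fin x ↔ A) (e₂ : Fin y ↔ B) (f : A ⊎ B → ℕ) →
  ∑ (f ∘ Inverse.to (+↔⊎-cong e₁ e₂)) ≡ ∑ (f ∘ inj₁ ∘ Inverse.to e₁) + ∑ (f ∘ inj₂ ∘ Inverse.to e₂)
∑-+↔⊎-cong {x} e₁ e₂ f = ∑-splitAt x (f ∘ Sum.map (Inverse.to e₁) (Inverse.to e₂))

module Relabel {V : Set} {n : ℕ} (code : Fin n ↔ V) (H : V → List V) where
  open Inverse code using (to; from; strictlyInverseˡ; strictlyInverseʳ)

  graph : Graph n
  graph x = map from (H (to x))

  ∈-graph⁺ : ∀ {u w} → w ∈ H u → from w ∈ graph (from u)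
  ∈-graph⁺ {u} {w} w∈ = subst (λ v → from w ∈ map from (H v)) (sym (strictlyInverseˡ u)) (∈-map⁺ from w∈)

  ∈-graph⁻ : ∀ {x y} → y ∈ graph x → to y ∈ H (to x)
  ∈-graph⁻ {x} y∈ with ∈-map⁻ from y∈
  ... | w , w∈ , refl = subst (_∈ H (to x)) (sym (strictlyInverseˡ w)) w∈

  deg-graph : ∀ x → deg graph x ≡ length (H (to x))
  deg-graph x = length-map from (H (to x))

  graph-simpleUndirected : (∀ u → Unique (u ∷ H u)) → (∀ u w → w ∈ H u → u ∈ H w) →
    SimpleUndirected graph
  graph-simpleUndirected unique symmetric = loopless , distinct , graph-symmetric
    where
    loopless : ∀ x → x ∉ graph x
    loopless x x∈ with unique (to x)
    ... | to-x∉ ∷ _ = All.lookup to-x∉ (∈-graph⁻ x∈) refl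

    distinct : ∀ x → Unique (graph x)
    distinct x with unique (to x)
    ... | _ ∷ H-unique = Unique.map⁺ (Injection.injective (↔⇒↣ (↔-sym code))) H-unique

    graph-symmetric : ∀ x y → y ∈ graph x → x ∈ graph y
    graph-symmetric x y y∈ =
      subst₂ (λ x′ y′ → x′ ∈ graph y′) (strictlyInverseʳ x) (strictlyInverseʳ y)
        (∈-graph⁺ (symmetric (to x) (to y) (∈-graph⁻ y∈)))

module Gadget (m : ℕ) where

  Vertex : Set
  Vertex = ⊤ ⊎ (Fin m ⊎ (Fin m ⊎ (⊤ ⊎ (Fin m ⊎ (Fin m × Fin m)))))

  pattern s     = inj₁ tt
  pattern a i   = inj₂ (inj₁ i)
  pattern b j   = inj₂ (inj₂ (inj₁ j))
  pattern r     = inj₂ (inj₂ (inj₂ (inj₁ tt)))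
  pattern h k   = inj₂ (inj₂ (inj₂ (inj₂ (inj₁ k))))
  pattern ℓ k l = inj₂ (inj₂ (inj₂ (inj₂ (inj₂ (k , l)))))

  Label : Set
  Label = Fin m × Fin m

  leaf : Label → Vertex
  leaf (k , l) = ℓ k l

  _≟ᴸ_ : DecidableEquality (Maybe Label)
  _≟ᴸ_ = Maybeₚ.≡-dec (Productₚ.≡-dec Fin._≟_ Fin._≟_)

  -- switchable w p z is an edge to w that the graph switched at p redirects to z.
  data Port : Set where
    fixed      : Vertex → Port
    switchable : Vertex → Label → Vertex → Port

  target : Maybe Label → Port → Vertex
  target q (fixed w) = w
  target q (switchable w p z) with q ≟ᴸ just p
  ... | yes _ = z
  ... | no _  = w

  target-switched : ∀ p w z → target (just p) (switchable w p z) ≡ z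
  target-switched p w z with just p ≟ᴸ just p
  ... | yes _  = refl
  ... | no p≢p = contradiction refl p≢p

  target-kept : ∀ {q p} w z → q ≢ just p → target q (switchable w p z) ≡ w
  target-kept {q} {p} w z q≢p with q ≟ᴸ just p
  ... | yes q≡p = contradiction q≡p q≢p
  ... | no _    = refl

  ports : Vertex → List Port
  ports s       = tabulate (fixed ∘ a) ++ tabulate (fixed ∘ b)
  ports (a i)   = fixed s ∷ tabulate (λ j → switchable (b j) (i , j) (h i))
  ports (b j)   = fixed s ∷ tabulate (λ i → switchable (a i) (i , j) (ℓ i j))
  ports r       = tabulate (fixed ∘ h)
  ports (h k)   = fixed r ∷ tabulate (λ l → switchable (ℓ k l) (k , l) (a k))
  ports (ℓ k l) = switchable (h k) (k , l) (b l) ∷ []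

  data PortOf : Vertex → Port → Set where
    s→a : ∀ i → PortOf s (fixed (a i))
    s→b : ∀ j → PortOf s (fixed (b j))
    a→s : ∀ i → PortOf (a i) (fixed s)
    a→b : ∀ i j → PortOf (a i) (switchable (b j) (i , j) (h i))
    b→s : ∀ j → PortOf (b j) (fixed s)
    b→a : ∀ i j → PortOf (b j) (switchable (a i) (i , j) (ℓ i j))
    r→h : ∀ k → PortOf r (fixed (h k))
    h→r : ∀ k → PortOf (h k) (fixed r)
    h→ℓ : ∀ k l → PortOf (h k) (switchable (ℓ k l) (k , l) (a k))
    ℓ→h : ∀ k l → PortOf (ℓ k l) (switchable (h k) (k , l) (b l))

  ∈-ports : ∀ {u π} → PortOf u π → π ∈ ports u
  ∈-ports (s→a i)   = ∈-++⁺ˡ (∈-tabulate⁺ i)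
  ∈-ports (s→b j)   = ∈-++⁺ʳ (tabulate (fixed ∘ a)) (∈-tabulate⁺ j)
  ∈-ports (a→s i)   = here refl
  ∈-ports (a→b i j) = there (∈-tabulate⁺ j)
  ∈-ports (b→s j)   = here refl
  ∈-ports (b→a i j) = there (∈-tabulate⁺ i)
  ∈-ports (r→h k)   = ∈-tabulate⁺ k
  ∈-ports (h→r k)   = here refl
  ∈-ports (h→ℓ k l) = there (∈-tabulate⁺ l)
  ∈-ports (ℓ→h k l) = here refl

  portOf : ∀ {u π} → π ∈ ports u → PortOf u π
  portOf {s} π∈ with ∈-++⁻ (tabulate (fixed ∘ a)) π∈
  ... | inj₁ π∈a with ∈-tabulate⁻ π∈a
  ...   | i , refl = s→a i
  portOf {s} π∈ | inj₂ π∈b with ∈-tabulate⁻ π∈b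
  ...   | j , refl = s→b j
  portOf {a i} (here refl) = a→s i
  portOf {a i} (there π∈) with ∈-tabulate⁻ π∈
  ... | j , refl = a→b i j
  portOf {b j} (here refl) = b→s j
  portOf {b j} (there π∈) with ∈-tabulate⁻ π∈
  ... | i , refl = b→a i j
  portOf {r} π∈ with ∈-tabulate⁻ π∈
  ... | k , refl = r→h k
  portOf {h k} (here refl) = h→r k
  portOf {h k} (there π∈) with ∈-tabulate⁻ π∈
  ... | l , refl = h→ℓ k l
  portOf {ℓ k l} (here refl) = ℓ→h k l

  fixed-mirror : ∀ {u w} → PortOf u (fixed w) → PortOf w (fixed u)
  fixed-mirror (s→a i) = a→s i
  fixed-mirror (s→b j) = b→s j
  fixed-mirror (a→s i) = s→a i
  fixed-mirror (b→s j) = s→b j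
  fixed-mirror (r→h k) = h→r k
  fixed-mirror (h→r k) = r→h k

  switchable-mirror : ∀ {u w p z} → PortOf u (switchable w p z) → ∃ λ z′ → PortOf w (switchable u p z′)
  switchable-mirror (a→b i j) = _ , b→a i j
  switchable-mirror (b→a i j) = _ , a→b i j
  switchable-mirror (h→ℓ k l) = _ , ℓ→h k l
  switchable-mirror (ℓ→h k l) = _ , h→ℓ k l

  replacement-mirror : ∀ {u w p z} → PortOf u (switchable w p z) → ∃ λ w′ → PortOf z (switchable w′ p u)
  replacement-mirror (a→b i j) = _ , h→ℓ i j
  replacement-mirror (b→a i j) = _ , ℓ→h i j
  replacement-mirror (h→ℓ k l) = _ , a→b k l
  replacement-mirror (ℓ→h k l) = _ , b→a k l

  Adj : Maybe Label → Vertex → List Vertex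
  Adj q u = map (target q) (ports u)

  Adj-symmetric : ∀ q u w → w ∈ Adj q u → u ∈ Adj q w
  Adj-symmetric q u w w∈ with ∈-map⁻ (target q) w∈
  ... | π , π∈ , refl = mirror π (portOf π∈)
    where
    mirror : ∀ π → PortOf u π → u ∈ Adj q (target q π)
    mirror (fixed w) port = ∈-map⁺ (target q) (∈-ports (fixed-mirror port))
    mirror (switchable w p z) port with q ≟ᴸ just p
    ... | yes refl with replacement-mirror port
    ...   | w′ , port′ = subst (_∈ Adj q z) (target-switched p w′ u) (∈-map⁺ (target q) (∈-ports port′))
    mirror (switchable w p z) port | no q≢p with switchable-mirror port
    ...   | z′ , port′ = subst (_∈ Adj q w) (target-kept u z′ q≢p) (∈-map⁺ (target q) (∈-ports port′))

  target-≢ : ∀ {u} q {w p z} → u ≢ w → u ≢ z → u ≢ target q (switchable w p z)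
  target-≢ q {w} {p} {z} u≢w u≢z with q ≟ᴸ just p
  ... | yes _ = u≢z
  ... | no _  = u≢w

  target-injective : ∀ {k} q {X Z : Fin k → Vertex} {L : Fin k → Label} →
    (∀ {i j} → X i ≡ X j → i ≡ j) → (∀ {i j} → L i ≡ L j → i ≡ j) → (∀ i j → Z i ≢ X j) →
    ∀ {i j} → target q (switchable (X i) (L i) (Z i)) ≡ target q (switchable (X j) (L j) (Z j)) → i ≡ j
  target-injective q {X} {Z} {L} X-inj L-inj Z∉X {i} {j} eq with q ≟ᴸ just (L i) | q ≟ᴸ just (L j)
  ... | yes refl | yes eq′ = L-inj (Maybeₚ.just-injective eq′)
  ... | yes _    | no _    = contradiction eq (Z∉X i j)
  ... | no _     | yes _   = contradiction (sym eq) (Z∉X j i)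
  ... | no _     | no _    = X-inj eq

  unique-∷-tabulate : ∀ {k x} {f : Fin k → Vertex} → (∀ i → x ≢ f i) → (∀ {i j} → f i ≡ f j → i ≡ j) →
    Unique (x ∷ tabulate f)
  unique-∷-tabulate x∉f f-inj = Allₚ.tabulate⁺ x∉f ∷ Unique.tabulate⁺ f-inj

  Adj-unique : ∀ q u → Unique (u ∷ Adj q u)
  Adj-unique q s
    rewrite map-++ (target q) (tabulate (fixed ∘ a)) (tabulate (fixed ∘ b))
          | map-tabulate (fixed ∘ a) (target q) | map-tabulate (fixed ∘ b) (target q)
    = Allₚ.++⁺ (Allₚ.tabulate⁺ {f = a} λ _ ()) (Allₚ.tabulate⁺ {f = b} λ _ ())
    ∷ Unique.++⁺ (Unique.tabulate⁺ λ { refl → refl }) (Unique.tabulate⁺ λ { refl → refl }) a∉b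
    where
    a∉b : ∀ {v} → ¬ (v ∈ tabulate a × v ∈ tabulate b)
    a∉b (v∈a , v∈b) with ∈-tabulate⁻ {f = a} v∈a | ∈-tabulate⁻ {f = b} v∈b
    ... | _ , refl | _ , ()
  Adj-unique q (a i) rewrite map-tabulate (λ j → switchable (b j) (i , j) (h i)) (target q) =
    ((λ ()) ∷ Allₚ.tabulate⁺ (λ j → target-≢ q (λ ()) (λ ())))
    ∷ unique-∷-tabulate (λ j → target-≢ q (λ ()) (λ ()))
        (target-injective q (λ { refl → refl }) (λ { refl → refl }) λ _ _ ())
  Adj-unique q (b j) rewrite map-tabulate (λ i → switchable (a i) (i , j) (ℓ i j)) (target q) =
    ((λ ()) ∷ Allₚ.tabulate⁺ (λ i → target-≢ q (λ ()) (λ ())))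
    ∷ unique-∷-tabulate (λ i → target-≢ q (λ ()) (λ ()))
        (target-injective q (λ { refl → refl }) (λ { refl → refl }) λ _ _ ())
  Adj-unique q r rewrite map-tabulate (fixed ∘ h) (target q) =
    unique-∷-tabulate (λ _ ()) λ { refl → refl }
  Adj-unique q (h k) rewrite map-tabulate (λ l → switchable (ℓ k l) (k , l) (a k)) (target q) =
    ((λ ()) ∷ Allₚ.tabulate⁺ (λ l → target-≢ q (λ ()) (λ ())))
    ∷ unique-∷-tabulate (λ l → target-≢ q (λ ()) (λ ()))
        (target-injective q (λ { refl → refl }) (λ { refl → refl }) λ _ _ ())
  Adj-unique q (ℓ k l) = (target-≢ q (λ ()) (λ ()) ∷ []) ∷ [] ∷ []

  n : ℕ
  n = 1 + (m + (m + (1 + (m + m * m))))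

  vertexCode : Fin n ↔ Vertex
  vertexCode =
    +↔⊎-cong 1↔⊤ (+↔⊎-cong ↔-refl (+↔⊎-cong ↔-refl (+↔⊎-cong 1↔⊤ (+↔⊎-cong ↔-refl *↔×))))

  decode : Fin n → Vertex
  decode = Inverse.to vertexCode

  encode : Vertex → Fin n
  encode = Inverse.from vertexCode

  open module Graphs (q : Maybe Label) = Relabel vertexCode (Adj q)
    using (graph; ∈-graph⁺; ∈-graph⁻; deg-graph) public

  graph-simpleUndirected : ∀ q → SimpleUndirected (graph q)
  graph-simpleUndirected q = Relabel.graph-simpleUndirected vertexCode (Adj q) (Adj-unique q) (Adj-symmetric q)

  degree : ∀ q x → deg (graph q) x ≡ length (ports (decode x))
  degree q x = trans (deg-graph q x) (length-map (target q) (ports (decode x)))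

  ports-length-s : length (ports s) ≡ m + m
  ports-length-s = trans (length-++ (tabulate (fixed ∘ a)))
    (cong₂ _+_ (length-tabulate (fixed ∘ a)) (length-tabulate (fixed ∘ b)))

  ports-length-≤ : 1 ≤ m → ∀ u → length (ports u) ≤ m + m
  ports-length-≤ 1≤m s       = ≤-reflexive ports-length-s
  ports-length-≤ 1≤m (a i)   = ≤-trans (≤-reflexive (cong suc (length-tabulate _))) (+-monoˡ-≤ m 1≤m)
  ports-length-≤ 1≤m (b j)   = ≤-trans (≤-reflexive (cong suc (length-tabulate _))) (+-monoˡ-≤ m 1≤m)
  ports-length-≤ 1≤m r       = ≤-trans (≤-reflexive (length-tabulate _)) (m≤m+n m m)
  ports-length-≤ 1≤m (h k)   = ≤-trans (≤-reflexive (cong suc (length-tabulate _))) (+-monoˡ-≤ m 1≤m)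
  ports-length-≤ 1≤m (ℓ k l) = ≤-trans 1≤m (m≤m+n m m)

  maxDeg-graph : ∀ q → 1 ≤ m → maxDeg (graph q) ≡ m + m
  maxDeg-graph q 1≤m = ≤-antisym
    (maximum-≤ _ (Allₚ.map⁺ (Allₚ.tabulate⁺ {f = id} λ x →
      ≤-trans (≤-reflexive (degree q x)) (ports-length-≤ 1≤m (decode x)))))
    (begin
      m + m                  ≡⟨ sym ports-length-s ⟩
      length (ports s)       ≡⟨ sym (degree q (encode s)) ⟩
      deg (graph q) (encode s) ≤⟨ ≤-maximum _ (∈-map⁺ (deg (graph q)) (∈-allFin (encode s))) ⟩
      maxDeg (graph q)       ∎)
    where open ≤-Reasoning

  ∑-decode : (f : Vertex → ℕ) → ∑ (f ∘ decode)
    ≡ f s + 0 + (∑ (f ∘ a) + (∑ (f ∘ b) + (f r + 0 + (∑ (f ∘ h) + ∑ (f ∘ leaf ∘ Inverse.to *↔×)))))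
  ∑-decode f =
    trans (∑-+↔⊎-cong 1↔⊤ code₁ f) (cong (f s + 0 +_)
    (trans (∑-+↔⊎-cong ↔-refl code₂ (f ∘ inj₂)) (cong (∑ (f ∘ a) +_)
    (trans (∑-+↔⊎-cong ↔-refl code₃ (f ∘ inj₂ ∘ inj₂)) (cong (∑ (f ∘ b) +_)
    (trans (∑-+↔⊎-cong 1↔⊤ code₄ (f ∘ inj₂ ∘ inj₂ ∘ inj₂)) (cong (f r + 0 +_)
    (∑-+↔⊎-cong ↔-refl *↔× (f ∘ inj₂ ∘ inj₂ ∘ inj₂ ∘ inj₂)))))))))
    where
    code₄ : Fin (m + m * m) ↔ (Fin m ⊎ Label)
    code₄ = +↔⊎-cong ↔-refl *↔×
    code₃ : Fin (1 + (m + m * m)) ↔ (⊤ ⊎ (Fin m ⊎ Label))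
    code₃ = +↔⊎-cong 1↔⊤ code₄
    code₂ : Fin (m + (1 + (m + m * m))) ↔ (Fin m ⊎ (⊤ ⊎ (Fin m ⊎ Label)))
    code₂ = +↔⊎-cong ↔-refl code₃
    code₁ : Fin (m + (m + (1 + (m + m * m)))) ↔ (Fin m ⊎ (Fin m ⊎ (⊤ ⊎ (Fin m ⊎ Label))))
    code₁ = +↔⊎-cong ↔-refl code₂

  ∑-ports : ∑ (length ∘ ports ∘ decode)
          ≡ (m + m) + 0 + (m * suc m + (m * suc m + (m + 0 + (m * suc m + m * m * 1))))
  ∑-ports rewrite ∑-decode (length ∘ ports) | ports-length-s
                | ∑-const {f = length ∘ ports ∘ a} (λ _ → cong suc (length-tabulate _))
                | ∑-const {f = length ∘ ports ∘ b} (λ _ → cong suc (length-tabulate _))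
                | ∑-const {f = length ∘ ports ∘ h} (λ _ → cong suc (length-tabulate _))
                | length-tabulate (fixed ∘ h) | ∑-const {m * m} {λ _ → 1} (λ _ → refl) = refl

  degSum-graph : ∀ q → degSum (graph q) ≤ 4 * n
  degSum-graph q = begin
    degSum (graph q)                 ≡⟨ cong sum (map-tabulate id (deg (graph q))) ⟩
    ∑ (deg (graph q))                ≡⟨ ∑-cong (degree q) ⟩
    ∑ (length ∘ ports ∘ decode)      ≡⟨ ∑-ports ⟩
    _                                ≤⟨ m≤m+n _ (6 * m + 8) ⟩
    _                                ≡⟨ solve 1 (λ m →
      (m :+ m) :+ con 0 :+ (m :* (con 1 :+ m) :+ (m :* (con 1 :+ m) :+ (m :+ con 0 :+ (m :* (con 1 :+ m) :+ m :* m :* con 1))))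
        :+ (con 6 :* m :+ con 8)
      := con 4 :* (con 1 :+ (m :+ (m :+ (con 1 :+ (m :+ m :* m)))))) refl m ⟩
    4 * n                            ∎
    where
    open ≤-Reasoning
    open +-*-Solver

  Near : Vertex → Set
  Near s     = ⊤
  Near (a _) = ⊤
  Near (b _) = ⊤
  Near _     = ⊥

  nearVertices : List Vertex
  nearVertices = s ∷ tabulate a ++ tabulate b

  near∈nearVertices : ∀ v → Near v → v ∈ nearVertices
  near∈nearVertices s     _ = here refl
  near∈nearVertices (a i) _ = there (∈-++⁺ˡ (∈-tabulate⁺ i))
  near∈nearVertices (b j) _ = there (∈-++⁺ʳ (tabulate a) (∈-tabulate⁺ j))

  r∉nearVertices : r ∉ nearVertices
  r∉nearVertices (there r∈) with ∈-++⁻ (tabulate a) r∈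
  ... | inj₁ r∈a with ∈-tabulate⁻ {f = a} r∈a
  ...   | _ , ()
  r∉nearVertices (there r∈) | inj₂ r∈b with ∈-tabulate⁻ {f = b} r∈b
  ...   | _ , ()

  length-nearVertices : length nearVertices ≡ suc (m + m)
  length-nearVertices = cong suc (trans (length-++ (tabulate {n = m} a))
    (cong₂ _+_ (length-tabulate {n = m} a) (length-tabulate {n = m} b)))

  unswitched-near : ∀ {u π} → Near u → PortOf u π → Near (target nothing π)
  unswitched-near _ (s→a i)   = tt
  unswitched-near _ (s→b j)   = tt
  unswitched-near _ (a→s i)   = tt
  unswitched-near _ (a→b i j) = subst Near (sym (target-kept {nothing} {i , j} (b j) (h i) λ ())) tt
  unswitched-near _ (b→s j)   = tt
  unswitched-near _ (b→a i j) = subst Near (sym (target-kept {nothing} {i , j} (a i) (ℓ i j) λ ())) tt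

  reachable-near : ∀ {t k} → Walk (graph nothing) (encode s) t k → Near (decode t)
  reachable-near here = subst Near (sym (Inverse.strictlyInverseˡ vertexCode s)) tt
  reachable-near (step {u} walk t∈) with ∈-map⁻ (target nothing) (∈-graph⁻ nothing {u} t∈)
  ... | π , π∈ , eq = subst Near (sym eq) (unswitched-near (reachable-near walk) (portOf π∈))

  -- Switching (i₀ , j₀) hangs the whole tree r, h, ℓ below a i₀ and b j₀.
  switched-connected : ∀ p → Connected (graph (just p))
  switched-connected (i₀ , j₀) = connected-from-root symmetric (encode s) λ x →
    subst (Reachable (encode s)) (Inverse.strictlyInverseʳ vertexCode x) (reach (decode x))
    where
    q : Maybe Label
    q = just (i₀ , j₀)

    symmetric : ∀ x y → y ∈ graph q x → x ∈ graph q y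
    symmetric = proj₂ (proj₂ (graph-simpleUndirected q))

    Reach : Vertex → Set
    Reach v = Reachable {G = graph q} (encode s) (encode v)

    along : ∀ {u π} → Reach u → PortOf u π → Reach (target q π)
    along {u} reach port = reachable-step reach (∈-graph⁺ q {u} (∈-map⁺ (target q) (∈-ports port)))

    from-s : Reach s
    from-s = 0 , here

    reach-h : ∀ k → Reach (h k)
    reach-h k = along (along h₀ (h→r i₀)) (r→h k)
      where
      h₀ : Reach (h i₀)
      h₀ = subst Reach (target-switched (i₀ , j₀) (b j₀) (h i₀)) (along (along from-s (s→a i₀)) (a→b i₀ j₀))

    reach : ∀ v → Reach v
    reach s       = from-s
    reach (a i)   = along from-s (s→a i)
    reach (b j)   = along from-s (s→b j)
    reach r       = along (reach-h i₀) (h→r i₀)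
    reach (h k)   = reach-h k
    reach (ℓ k l) with q ≟ᴸ just (k , l)
    ... | yes refl = subst Reach (target-switched (k , l) (a k) (ℓ k l)) (along (along from-s (s→b l)) (b→a k l))
    ... | no q≢kl  = subst Reach (target-kept (ℓ k l) (a k) q≢kl) (along (reach-h k) (h→ℓ k l))

  nearCodes : List (Fin n)
  nearCodes = map encode nearVertices

  length-nearCodes : length nearCodes ≡ suc (m + m)
  length-nearCodes = trans (length-map encode nearVertices) length-nearVertices

  reachable∈nearCodes : ∀ {t k} → Walk (graph nothing) (encode s) t k → t ∈ nearCodes
  reachable∈nearCodes {t} walk = subst (_∈ nearCodes) (Inverse.strictlyInverseʳ vertexCode t)
    (∈-map⁺ encode (near∈nearVertices (decode t) (reachable-near walk)))

  r∉nearCodes : encode r ∉ nearCodes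
  r∉nearCodes r∈ with ∈-map⁻ encode {xs = nearVertices} r∈
  ... | v , v∈ , eq =
    r∉nearVertices (subst (_∈ nearVertices) (sym (Injection.injective (↔⇒↣ (↔-sym vertexCode)) eq)) v∈)

  label : Port → Maybe Label
  label (fixed _)          = nothing
  label (switchable _ p _) = just p

  queryLabel : Fin n × ℕ → Maybe Label
  queryLabel (x , i) = maybe label nothing (nth (ports (decode x)) i)

  target-unlabelled : ∀ p π → label π ≢ just p → target nothing π ≡ target (just p) π
  target-unlabelled p (fixed w) _ = refl
  target-unlabelled p (switchable w p′ z) p′≢p =
    trans (target-kept {nothing} {p′} w z λ ()) (sym (target-kept w z (p′≢p ∘ sym)))

  agree-off-label : ∀ p query → queryLabel query ≢ just p → AgreeAt (graph nothing) (graph (just p)) query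
  agree-off-label p (x , i) off
    rewrite nth-map encode (Adj nothing (decode x)) i | nth-map (target nothing) (ports (decode x)) i
          | nth-map encode (Adj (just p) (decode x)) i | nth-map (target (just p)) (ports (decode x)) i
    with nth (ports (decode x)) i
  ... | nothing = refl
  ... | just π  = cong (just ∘ encode) (target-unlabelled p π off)

  switches : List (Maybe Label)
  switches = tabulate (just ∘ Inverse.to (*↔× {m} {m}))

  hidden-label : (queries : List (Fin n × ℕ)) → length queries < m * m →
    ∃ λ p → All (AgreeAt (graph nothing) (graph (just p))) queries
  hidden-label queries short with shorter⇒∃∉ _≟ᴸ_ {xs = switches} {ys = map queryLabel queries}
    (Unique.tabulate⁺ (Injection.injective (↔⇒↣ *↔×) ∘ Maybeₚ.just-injective))
    (subst₂ _<_ (sym (length-map queryLabel queries)) (sym (length-tabulate {n = m * m} _)) short)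
  ... | x , x∈ , x∉ with ∈-tabulate⁻ x∈
  ...   | k , refl = Inverse.to *↔× k , All.tabulate λ {query} q∈ →
    agree-off-label _ query λ eq → x∉ (subst (_∈ map queryLabel queries) eq (∈-map⁺ queryLabel q∈))

pred[m*m]≤[2+m+m]*d⇒m+m≤6*d : ∀ m d → 1 ≤ d → pred (m * m) ≤ (2 + (m + m)) * d → m + m ≤ 6 * d
pred[m*m]≤[2+m+m]*d⇒m+m≤6*d zero d _ _ = z≤n
pred[m*m]≤[2+m+m]*d⇒m+m≤6*d (suc D) d 1≤d steps≤ = begin
  suc D + suc D        ≡⟨ solve 1 (λ D → (con 1 :+ D) :+ (con 1 :+ D) := con 2 :* con 1 :+ con 2 :* D) refl D ⟩
  2 * 1 + 2 * D        ≤⟨ +-mono-≤ (*-monoʳ-≤ 2 1≤d) (*-monoʳ-≤ 2 D≤2d) ⟩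
  2 * d + 2 * (2 * d)  ≡⟨ solve 1 (λ d → con 2 :* d :+ con 2 :* (con 2 :* d) := con 6 :* d) refl d ⟩
  6 * d                ∎
  where
  open ≤-Reasoning
  open +-*-Solver
  D≤2d : D ≤ 2 * d
  D≤2d = *-cancelʳ-≤ D (2 * d) (2 + D) (begin
    D * (2 + D)                 ≡⟨ solve 1 (λ D → D :* (con 2 :+ D) := D :+ D :* (con 1 :+ D)) refl D ⟩
    D + D * suc D               ≤⟨ steps≤ ⟩
    (2 + (suc D + suc D)) * d   ≡⟨ solve 2 (λ D d → (con 2 :+ ((con 1 :+ D) :+ (con 1 :+ D))) :* d
                                                := con 2 :* d :* (con 2 :+ D)) refl D d ⟩
    2 * d * (2 + D)             ∎)

module Adversary (A : Algorithm) (solves : SolvesSSSD A) (D : ℕ) where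
  m : ℕ
  m = suc D

  open Gadget m public

  -- m * m ≡ suc K, so the first K steps make fewer neighbour queries than there are switches.
  K : ℕ
  K = pred (m * m)

  hidden : ∃ λ p → All (AgreeAt (graph nothing) (graph (just p)))
                         (neighbourQueries A (graph nothing) (Algorithm.init A n (encode s)) K)
  hidden = hidden-label _ (s≤s (length-neighbourQueries A _ _ K))

  p : Label
  p = proj₁ hidden

  G : Graph n
  G = graph (just p)

  same-prefix : trace A (graph nothing) (encode s) K ≡ trace A G (encode s) K
  same-prefix = run-cong A (λ x → trans (degree nothing x) (sym (degree (just p) x))) _ K (proj₂ hidden)

  maxDeg-G : maxDeg G ≡ m + m
  maxDeg-G = maxDeg-graph (just p) (s≤s z≤n)

  D≤maxDeg : D ≤ maxDeg G
  D≤maxDeg = subst (D ≤_) (sym maxDeg-G) (≤-trans (n≤1+n D) (m≤m+n m m))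

  maxDeg≤6*delay : ∀ fuel → Terminated (trace A G (encode s) fuel) →
    maxDeg G ≤ 6 * delay (trace A G (encode s) fuel)
  maxDeg≤6*delay fuel stops = subst (_≤ 6 * d) (sym maxDeg-G)
    (pred[m*m]≤[2+m+m]*d⇒m+m≤6*d m d (1≤delay _ stops) (subst (λ N → K ≤ suc N * d) length-nearCodes
      (indistinguishable⇒slow A solves (graph-simpleUndirected nothing) (graph-simpleUndirected (just p))
        (switched-connected p) nearCodes reachable∈nearCodes (encode r , r∉nearCodes) same-prefix fuel stops)))
    where
    d : ℕ
    d = delay (trace A G (encode s) fuel)

theorem2 : (A : Algorithm) → SolvesSSSD A →
    Σ ℕ λ c → Σ ℕ λ C → (D : ℕ) →
      Σ ℕ λ n → Σ (Graph n) λ G → Σ (Fin n) λ s →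
        SimpleUndirected G × Connected G × degSum G ≤ C * n × D ≤ maxDeg G ×
        ((fuel : ℕ) → Terminated (trace A G s fuel) →
          maxDeg G ≤ suc c * delay (trace A G s fuel))
theorem2 A solves = 5 , 4 , λ D → let open Adversary A solves D in
  n , G , encode s , graph-simpleUndirected (just p) , switched-connected p , degSum-graph (just p) ,
  D≤maxDeg , maxDeg≤6*delay
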